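{- For every integer $n \geq 4$, $$\sigma^{ - }(P(n,1)) = \begin{cases} 4 & \text{if } n \text{ is even},\\ 5 & \text{if } n \text{ is odd}.\end{cases}$$
   Context: For $n \geq 3$, $k \geq 1$ with $2k<n$, the generalized Petersen graph $P(n,k)$ has vertex set $\{u_i, v_i : i=0,1,\dots,n-1\}$ and edge set $\{u_iu_{i+1},\ u_iv_i,\ v_iv_{i+k} : i=0,\dots,n-1\}$, subscripts read modulo $n$. For a simple connected graph $G$ of order $N$, the \textbf{rna} number $\sigma^{ - }(G)$ is the minimum, over all bijections $f: V(G)\to\{1,2,\dots,N\}$, of the number of edges $uv$ of $G$ such that $f(u)$ and $f(v)$ have different parity. -}

module Defs where

open import Data.Nat using (ℕ; zero; suc; _+_; _%_; _≤_)
open import Data.Nat.DivMod using (m%n<n)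
open import Data.Fin using (Fin; toℕ; fromℕ<)
open import Data.Sum using (_⊎_; inj₁; inj₂)
open import Data.Product using (Σ; _×_)
open import Data.List using (List; []; _∷_; _++_; length; filter; concatMap)
open import Data.List.Base using (allFin)
open import Data.Bool using (Bool; true; false; if_then_else_)
open import Relation.Nullary using (¬_; does)
open import Function.Bundles using (_⤖_; Bijection)
import Data.Nat as ℕ

shift : ∀ {n} → ℕ → Fin n → Fin n
shift {suc m} k i = fromℕ< (m%n<n (toℕ i + k) (suc m))

-- Vertices of P(n,k): inj₁ i = u_i, inj₂ i = v_i
PV : ℕ → Set
PV n = Fin n ⊎ Fin n

-- Edge list of P(n,k): for each i, u_i u_{i+1}, u_i v_i, v_i v_{i+k}.
-- (For 2k < n and n ≥ 3 these 3n edges are pairwise distinct.)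
PEdges : (n k : ℕ) → List (PV n × PV n)
PEdges n k = concatMap (λ i →
    (inj₁ i Data.Product., inj₁ (shift 1 i))
  ∷ (inj₁ i Data.Product., inj₂ i)
  ∷ (inj₂ i Data.Product., inj₂ (shift k i))
  ∷ []) (allFin n)

label : ∀ {N} {V : Set} → (V → Fin N) → V → ℕ
label f x = suc (toℕ (f x))

oddEdge : ∀ {N} {V : Set} → (V → Fin N) → V × V → Bool
oddEdge f (a Data.Product., b) = if does (label f a % 2 ℕ.≟ label f b % 2) then false else true

oddCount : ∀ {N} {V : Set} → List (V × V) → (V → Fin N) → ℕ
oddCount E f = length (filter (λ e → oddEdge f e Data.Bool.≟ true) E)

IsRnaPetersen : (n k m : ℕ) → Set
IsRnaPetersen n k m =
  Σ (PV n ⤖ Fin (n + n)) (λ f → oddCount (PEdges n k) (Bijection.to f) ≡ m)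
  × ((f : PV n ⤖ Fin (n + n)) → m ≤ oddCount (PEdges n k) (Bijection.to f))
  where open import Relation.Binary.PropositionalEquality using (_≡_)

even? : ℕ → Bool
even? zero = true
even? (suc zero) = false
even? (suc (suc n)) = even? n

module Submission where

-- Colour every vertex by the parity of its label; since the labelling is a bijection onto
-- 1 … 2n, exactly n vertices get each colour. An edge is odd iff it joins the two colours, so
-- the odd edges are the colour changes around the outer cycle u₀ … uₙ₋₁, the two-coloured
-- spokes uᵢvᵢ, and the colour changes around the inner cycle v₀ … vₙ₋₁. A cycle changes colour
-- an even number of times. If one cycle is monochromatic, the other one carries the other colour
-- and all n spokes are odd. Otherwise each cycle changes colour at least twice, and since the
-- number of two-coloured spokes is congruent to the number of vertices of one colour, i.e. to
-- n, modulo 2, an odd n forces one more odd edge.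
-- Conversely, give odd labels to the first n vertices of the sequence u₀, v₀, u₁, v₁, …: then
-- each cycle changes colour twice and only the spoke uₖvₖ with 2k + 1 = n can be odd.

open import Defs
open import Data.Bool using (Bool; true; false; not; _xor_; _∧_; if_then_else_)
import Data.Bool as Bool
open import Data.Bool.Properties using (not-involutive; xor-same; xor-comm; ≤-minimum)
open import Data.Empty using (⊥-elim)
open import Data.Fin as Fin using (Fin; toℕ; fromℕ<; reduce≥; splitAt; cast; combine)
open import Data.Fin.Patterns using (0F; 1F)
open import Data.Fin.Properties
  using (toℕ<n; toℕ-injective; toℕ-fromℕ<; toℕ-cast; toℕ-combine; cast-involutive;
         splitAt-<; splitAt-≥; +↔⊎; *↔×)
open import Data.List using (List; []; _∷_; _++_; length; filter; map; concatMap; tabulate; allFin)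
open import Data.List.Properties using (map-++)
open import Data.Nat using (ℕ; zero; suc; _+_; _*_; _≤_; _<_; _%_; z≤n; s≤s; NonZero; _≤ᵇ_)
open import Data.Nat.DivMod using (_mod_; m<n⇒m%n≡m; n%n≡0; [m+n]%n≡m%n)
import Data.Nat.ListAction as List
open import Data.Nat.ListAction.Properties using (sum-++)
open import Data.Nat.Properties
open import Data.Product using (_×_; _,_)
open import Data.Sum using (_⊎_; inj₁; inj₂)
import Data.Sum as Sum
open import Function.Bundles using (_⤖_; _↔_; Bijection; Inverse; mk↔ₛ′)
open import Function.Construct.Composition using (_↔-∘_)
open import Function.Properties.Bijection using (⤖⇒↔)
open import Function.Properties.Inverse using (↔⇒⤖; ↔-sym)
open import Relation.Binary.PropositionalEquality
open import Relation.Nullary using (yes; no)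
open import Relation.Nullary.Reflects using (ofʸ; ofⁿ)
open import Algebra.Properties.CommutativeMonoid.Sum +-0-commutativeMonoid
  using (sum; sum-syntax; ∑-distrib-+; sum-cong-≗; sum-permute)

even?-suc : ∀ n → even? (suc n) ≡ not (even? n)
even?-suc zero = refl
even?-suc (suc zero) = refl
even?-suc (suc (suc n)) = even?-suc n

even?-+ : ∀ m n → even? (m + n) ≡ not (even? m xor even? n)
even?-+ zero n = sym (not-involutive (even? n))
even?-+ (suc zero) n = even?-suc n
even?-+ (suc (suc m)) n = even?-+ m n

even?-double : ∀ n → even? (n + n) ≡ true
even?-double n = trans (even?-+ n n) (cong not (xor-same (even? n)))

even?-2* : ∀ n → even? (2 * n) ≡ true
even?-2* n = trans (cong (λ k → even? (n + k)) (+-identityʳ n)) (even?-double n)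

even?-+-double : ∀ m k → even? (m + (k + k)) ≡ even? m
even?-+-double m k rewrite even?-+ m (k + k) | even?-double k | xor-comm (even? m) true =
  not-involutive (even? m)

even?-nonzero⇒2≤ : ∀ {m} → even? m ≡ true → m ≢ 0 → 2 ≤ m
even?-nonzero⇒2≤ {zero} _ m≢0 = ⊥-elim (m≢0 refl)
even?-nonzero⇒2≤ {suc (suc m)} _ _ = s≤s (s≤s z≤n)

𝟙 : Bool → ℕ
𝟙 false = 0
𝟙 true = 1

𝟙≤1 : ∀ b → 𝟙 b ≤ 1
𝟙≤1 false = z≤n
𝟙≤1 true = ≤-refl

n%2 : ∀ n → n % 2 ≡ 𝟙 (not (even? n))
n%2 zero = refl
n%2 (suc zero) = refl
n%2 (suc (suc n)) = trans (cong (_% 2) (+-comm 2 n)) (trans ([m+n]%n≡m%n n 2) (n%2 n))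

𝟙-odd≤ : ∀ {m b} → even? m ≡ b → 𝟙 (not b) ≤ m
𝟙-odd≤ {zero} refl = z≤n
𝟙-odd≤ {suc zero} refl = s≤s z≤n
𝟙-odd≤ {suc (suc m)} {true} _ = z≤n
𝟙-odd≤ {suc (suc m)} {false} _ = s≤s z≤n

≤1⇒≤𝟙-odd : ∀ {m b} → even? m ≡ b → m ≤ 1 → m ≤ 𝟙 (not b)
≤1⇒≤𝟙-odd {zero} _ _ = z≤n
≤1⇒≤𝟙-odd {suc zero} refl _ = s≤s z≤n
≤1⇒≤𝟙-odd {suc (suc m)} _ (s≤s ())

σ⁻P : ℕ → ℕ
σ⁻P n = if even? n then 4 else 5

σ⁻P-split : ∀ n → σ⁻P n ≡ 2 + 𝟙 (not (even? n)) + 2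
σ⁻P-split n with even? n
... | false = refl
... | true = refl

σ⁻P≤n : ∀ {n} → 4 ≤ n → σ⁻P n ≤ n
σ⁻P≤n {n} 4≤n with m≤n⇒m<n∨m≡n 4≤n
... | inj₂ refl = ≤-refl
... | inj₁ 5≤n =
  ≤-trans (subst (_≤ 5) (sym (σ⁻P-split n)) (+-monoˡ-≤ 2 (+-monoʳ-≤ 2 (𝟙≤1 _)))) 5≤n

-- Colour changes of Boolean sequences

count : (ℕ → Bool) → ℕ → ℕ
count b n = ∑[ i < n ] 𝟙 (b (toℕ i))

sum-mono-≤ : ∀ {n} {f g : Fin n → ℕ} → (∀ i → f i ≤ g i) → sum f ≤ sum g
sum-mono-≤ {zero} _ = z≤n
sum-mono-≤ {suc n} f≤g = +-mono-≤ (f≤g Fin.zero) (sum-mono-≤ (λ i → f≤g (Fin.suc i)))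

count-cong : ∀ {b c} n → (∀ k → k < n → b k ≡ c k) → count b n ≡ count c n
count-cong n eq = sum-cong-≗ {n} (λ i → cong 𝟙 (eq (toℕ i) (toℕ<n i)))

count-snoc : ∀ b n → count b (suc n) ≡ count b n + 𝟙 (b n)
count-snoc b zero = +-identityʳ (𝟙 (b 0))
count-snoc b (suc n) = trans (cong (𝟙 (b 0) +_) (count-snoc (λ k → b (suc k)) n))
                             (sym (+-assoc (𝟙 (b 0)) _ _))

count-constant : ∀ {b c} n → (∀ k → k < n → b k ≡ c) → count b n ≡ n * 𝟙 c
count-constant zero _ = refl
count-constant (suc n) eq =
  cong₂ _+_ (cong 𝟙 (eq 0 (s≤s z≤n))) (count-constant n (λ k k<n → eq (suc k) (s≤s k<n)))

count≡0 : ∀ {b} n → count b n ≡ 0 → ∀ k → k < n → b k ≡ false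
count≡0 {b} (suc n) none zero _ with b 0 | m+n≡0⇒m≡0 (𝟙 (b 0)) none
... | false | _ = refl
... | true | ()
count≡0 {b} (suc n) none (suc k) (s≤s k<n) = count≡0 n (m+n≡0⇒n≡0 (𝟙 (b 0)) none) k k<n

count-unique : ∀ {b} n → (∀ j k → b j ≡ true → b k ≡ true → j ≡ k) → count b n ≤ 1
count-unique zero _ = z≤n
count-unique {b} (suc n) unique with b 0 in b0
... | false = count-unique n (λ j k bj bk → suc-injective (unique (suc j) (suc k) bj bk))
... | true = ≤-reflexive (cong suc (trans (count-constant n none) (*-zeroʳ n)))
  where
  none : ∀ k → k < n → b (suc k) ≡ false
  none k _ with b (suc k) in bk
  ... | false = refl
  ... | true with () ← unique 0 (suc k) b0 bk

changes : (ℕ → Bool) → ℕ → ℕ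
changes h = count (λ k → h k xor h (suc k))

mismatches : (ℕ → Bool) → (ℕ → Bool) → ℕ → ℕ
mismatches α β = count (λ k → α k xor β k)

mismatches-comm : ∀ α β n → mismatches α β n ≡ mismatches β α n
mismatches-comm α β n = count-cong n (λ k _ → xor-comm (α k) (β k))

𝟙-+ : ∀ a b → 𝟙 a + 𝟙 b ≡ 𝟙 (a xor b) + (𝟙 (a ∧ b) + 𝟙 (a ∧ b))
𝟙-+ false false = refl
𝟙-+ false true = refl
𝟙-+ true false = refl
𝟙-+ true true = refl

count-+-count : ∀ α β n → count α n + count β n
              ≡ mismatches α β n + (count (λ k → α k ∧ β k) n + count (λ k → α k ∧ β k) n)
count-+-count α β n = begin
  count α n + count β n
    ≡⟨ ∑-distrib-+ {n} (λ i → 𝟙 (α (toℕ i))) (λ i → 𝟙 (β (toℕ i))) ⟨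
  ∑[ i < n ] (𝟙 (α (toℕ i)) + 𝟙 (β (toℕ i)))
    ≡⟨ sum-cong-≗ {n} (λ i → 𝟙-+ (α (toℕ i)) (β (toℕ i))) ⟩
  ∑[ i < n ] (𝟙 (α (toℕ i) xor β (toℕ i)) + (𝟙 (α (toℕ i) ∧ β (toℕ i)) + 𝟙 (α (toℕ i) ∧ β (toℕ i))))
    ≡⟨ ∑-distrib-+ {n} _ _ ⟩
  mismatches α β n + ∑[ i < n ] (𝟙 (α (toℕ i) ∧ β (toℕ i)) + 𝟙 (α (toℕ i) ∧ β (toℕ i)))
    ≡⟨ cong (mismatches α β n +_) (∑-distrib-+ {n} _ _) ⟩
  mismatches α β n + (count (λ k → α k ∧ β k) n + count (λ k → α k ∧ β k) n) ∎
  where open ≡-Reasoning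

mismatches-parity : ∀ α β n → count α n + count β n ≡ n → even? (mismatches α β n) ≡ even? n
mismatches-parity α β n total = begin
  even? (mismatches α β n)                  ≡⟨ even?-+-double (mismatches α β n) both ⟨
  even? (mismatches α β n + (both + both))  ≡⟨ cong even? (count-+-count α β n) ⟨
  even? (count α n + count β n)             ≡⟨ cong even? total ⟩
  even? n                                   ∎
  where
  open ≡-Reasoning
  both = count (λ k → α k ∧ β k) n

-- On a closed walk the rotation h ∘ suc has the same count as h, so count-+-count makes
-- changes h n even.
changes-closed-even : ∀ h n → h n ≡ h 0 → even? (changes h n) ≡ true
changes-closed-even h n closed = begin
  even? (changes h n)                            ≡⟨ even?-+-double (changes h n) both ⟨
  even? (changes h n + (both + both))            ≡⟨ cong even? (count-+-count h (λ k → h (suc k)) n) ⟨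
  even? (count h n + count (λ k → h (suc k)) n)  ≡⟨ cong (λ c → even? (count h n + c)) rotation ⟩
  even? (count h n + count h n)                  ≡⟨ even?-double (count h n) ⟩
  true                                           ∎
  where
  open ≡-Reasoning
  both = count (λ k → h k ∧ h (suc k)) n
  rotation : count (λ k → h (suc k)) n ≡ count h n
  rotation = +-cancelˡ-≡ (𝟙 (h 0)) _ _
    (trans (count-snoc h n) (trans (cong (λ b → count h n + 𝟙 b) closed) (+-comm (count h n) (𝟙 (h 0)))))

xor≡false⇒≡ : ∀ a b → a xor b ≡ false → a ≡ b
xor≡false⇒≡ false false _ = refl
xor≡false⇒≡ true true _ = refl

changes≡0⇒constant : ∀ h n → changes h n ≡ 0 → ∀ k → k < n → h k ≡ h 0
changes≡0⇒constant h n _ zero _ = refl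
changes≡0⇒constant h n none (suc k) k<n =
  trans (sym (xor≡false⇒≡ (h k) (h (suc k)) (count≡0 n none k (<⇒≤ k<n))))
        (changes≡0⇒constant h n none k (<⇒≤ k<n))

𝟙-≤-xor : ∀ a b → 𝟙 b ≤ 𝟙 a + 𝟙 (a xor b)
𝟙-≤-xor false false = z≤n
𝟙-≤-xor false true = s≤s z≤n
𝟙-≤-xor true false = z≤n
𝟙-≤-xor true true = s≤s z≤n

count≤count+mismatches : ∀ α β n → count β n ≤ count α n + mismatches α β n
count≤count+mismatches α β n = begin
  count β n
    ≤⟨ sum-mono-≤ {n} (λ i → 𝟙-≤-xor (α (toℕ i)) (β (toℕ i))) ⟩
  ∑[ i < n ] (𝟙 (α (toℕ i)) + 𝟙 (α (toℕ i) xor β (toℕ i)))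
    ≡⟨ ∑-distrib-+ {n} _ _ ⟩
  count α n + mismatches α β n ∎
  where open ≤-Reasoning

monochromatic⇒n≤mismatches : ∀ α β n c → (∀ k → k < n → α k ≡ c) →
                              count α n + count β n ≡ n → n ≤ mismatches α β n
monochromatic⇒n≤mismatches α β n false constant total = begin
  n                             ≡⟨ trans (cong (_+ count β n) (sym α≡0)) total ⟨
  count β n                     ≤⟨ count≤count+mismatches α β n ⟩
  count α n + mismatches α β n  ≡⟨ cong (_+ mismatches α β n) α≡0 ⟩
  mismatches α β n              ∎
  where
  open ≤-Reasoning
  α≡0 : count α n ≡ 0
  α≡0 = trans (count-constant n constant) (*-zeroʳ n)
monochromatic⇒n≤mismatches α β n true constant total = begin
  n                             ≡⟨ α≡n ⟨
  count α n                     ≤⟨ count≤count+mismatches β α n ⟩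
  count β n + mismatches β α n  ≡⟨ cong₂ _+_ β≡0 (mismatches-comm β α n) ⟩
  mismatches α β n              ∎
  where
  open ≤-Reasoning
  α≡n : count α n ≡ n
  α≡n = trans (count-constant n constant) (*-identityʳ n)
  β≡0 : count β n ≡ 0
  β≡0 = +-cancelˡ-≡ n _ _ (trans (trans (cong (_+ count β n) (sym α≡n)) total) (sym (+-identityʳ n)))

n≤mismatches⇒σ⁻P≤ : ∀ α β n → 4 ≤ n → n ≤ mismatches α β n →
                     σ⁻P n ≤ changes α n + mismatches α β n + changes β n
n≤mismatches⇒σ⁻P≤ α β n 4≤n n≤m = ≤-trans (σ⁻P≤n 4≤n)
  (≤-trans n≤m (≤-trans (m≤n+m _ (changes α n)) (m≤m+n _ (changes β n))))

rna-lower-bound : ∀ α β n → 4 ≤ n → α n ≡ α 0 → β n ≡ β 0 → count α n + count β n ≡ n →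
                  σ⁻P n ≤ changes α n + mismatches α β n + changes β n
rna-lower-bound α β n 4≤n αn βn total with changes α n ≟ 0 | changes β n ≟ 0
... | yes α-constant | _ =
  n≤mismatches⇒σ⁻P≤ α β n 4≤n
    (monochromatic⇒n≤mismatches α β n (α 0) (changes≡0⇒constant α n α-constant) total)
... | no _ | yes β-constant =
  n≤mismatches⇒σ⁻P≤ α β n 4≤n (subst (n ≤_) (mismatches-comm β α n)
    (monochromatic⇒n≤mismatches β α n (β 0) (changes≡0⇒constant β n β-constant)
      (trans (+-comm (count β n) (count α n)) total)))
... | no α-changes | no β-changes = begin
  σ⁻P n
    ≡⟨ σ⁻P-split n ⟩
  2 + 𝟙 (not (even? n)) + 2
    ≤⟨ +-mono-≤ (+-mono-≤ (even?-nonzero⇒2≤ (changes-closed-even α n αn) α-changes)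
                          (𝟙-odd≤ (mismatches-parity α β n total)))
                (even?-nonzero⇒2≤ (changes-closed-even β n βn) β-changes) ⟩
  changes α n + mismatches α β n + changes β n ∎
  where open ≤-Reasoning

Increasing : (ℕ → Bool) → Set
Increasing h = ∀ k → h k Bool.≤ h (suc k)

𝟙-+-xor : ∀ {a b} → a Bool.≤ b → 𝟙 a + 𝟙 (a xor b) ≡ 𝟙 b
𝟙-+-xor Bool.f≤t = refl
𝟙-+-xor {false} Bool.b≤b = refl
𝟙-+-xor {true} Bool.b≤b = refl

changes-increasing : ∀ h n → Increasing h → 𝟙 (h 0) + changes h n ≡ 𝟙 (h n)
changes-increasing h zero _ = +-identityʳ (𝟙 (h 0))
changes-increasing h (suc n) increasing = begin
  𝟙 (h 0) + (𝟙 (h 0 xor h 1) + changes (λ k → h (suc k)) n)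
    ≡⟨ +-assoc (𝟙 (h 0)) _ _ ⟨
  𝟙 (h 0) + 𝟙 (h 0 xor h 1) + changes (λ k → h (suc k)) n
    ≡⟨ cong (_+ changes (λ k → h (suc k)) n) (𝟙-+-xor (increasing 0)) ⟩
  𝟙 (h 1) + changes (λ k → h (suc k)) n
    ≡⟨ changes-increasing (λ k → h (suc k)) n (λ k → increasing (suc k)) ⟩
  𝟙 (h (suc n)) ∎
  where open ≡-Reasoning

changes-increasing≤1 : ∀ h n → Increasing h → changes h n ≤ 1
changes-increasing≤1 h n increasing = ≤-trans (m≤n+m (changes h n) (𝟙 (h 0)))
  (subst (_≤ 1) (sym (changes-increasing h n increasing)) (𝟙≤1 (h n)))

closed-changes≤2 : ∀ h g m → Increasing g → (∀ k → k < suc m → h k ≡ g k) → changes h (suc m) ≤ 2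
closed-changes≤2 h g m increasing agree = begin
  changes h (suc m)                    ≡⟨ count-snoc (λ k → h k xor h (suc k)) m ⟩
  changes h m + 𝟙 (h m xor h (suc m))  ≡⟨ cong (_+ 𝟙 (h m xor h (suc m))) (count-cong m agree-below) ⟩
  changes g m + 𝟙 (h m xor h (suc m))  ≤⟨ +-mono-≤ (changes-increasing≤1 g m increasing) (𝟙≤1 _) ⟩
  2                                    ∎
  where
  open ≤-Reasoning
  agree-below : ∀ k → k < m → h k xor h (suc k) ≡ g k xor g (suc k)
  agree-below k k<m = cong₂ _xor_ (agree k (m<n⇒m<1+n k<m)) (agree (suc k) (s≤s k<m))

-- The colourings of P(n,1) induced by a labelling

length-filter : ∀ {A : Set} (p : A → Bool) xs →
                length (filter (λ x → p x Bool.≟ true) xs) ≡ List.sum (map (λ x → 𝟙 (p x)) xs)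
length-filter p [] = refl
length-filter p (x ∷ xs) with p x
... | true = cong suc (length-filter p xs)
... | false = length-filter p xs

sum-map-concatMap : ∀ {A B : Set} (c : B → ℕ) (g : A → List B) xs →
  List.sum (map c (concatMap g xs)) ≡ List.sum (map (λ x → List.sum (map c (g x))) xs)
sum-map-concatMap c g [] = refl
sum-map-concatMap c g (x ∷ xs) = begin
  List.sum (map c (g x ++ concatMap g xs))
    ≡⟨ cong List.sum (map-++ c (g x) _) ⟩
  List.sum (map c (g x) ++ map c (concatMap g xs))
    ≡⟨ sum-++ (map c (g x)) _ ⟩
  List.sum (map c (g x)) + List.sum (map c (concatMap g xs))
    ≡⟨ cong (List.sum (map c (g x)) +_) (sum-map-concatMap c g xs) ⟩
  List.sum (map c (g x)) + List.sum (map (λ x → List.sum (map c (g x))) xs) ∎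
  where open ≡-Reasoning

sum-map-tabulate : ∀ {A : Set} {n} (c : A → ℕ) (g : Fin n → A) →
                   List.sum (map c (tabulate g)) ≡ ∑[ i < n ] c (g i)
sum-map-tabulate {n = zero} c g = refl
sum-map-tabulate {n = suc n} c g = cong (c (g Fin.zero) +_) (sum-map-tabulate c (λ i → g (Fin.suc i)))

∑-splitAt : ∀ m {n} (w : Fin m ⊎ Fin n → ℕ) →
            ∑[ j < m + n ] w (splitAt m j) ≡ ∑[ i < m ] w (inj₁ i) + ∑[ i < n ] w (inj₂ i)
∑-splitAt zero w = refl
∑-splitAt (suc m) w = trans (cong (w (inj₁ Fin.zero) +_) (∑-splitAt m (λ x → w (Sum.map₁ Fin.suc x))))
                            (sym (+-assoc (w (inj₁ Fin.zero)) _ _))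

∑-bijection : ∀ {m n k} (e : (Fin m ⊎ Fin n) ⤖ Fin k) (w : Fin k → ℕ) →
              ∑[ i < m ] w (Bijection.to e (inj₁ i)) + ∑[ i < n ] w (Bijection.to e (inj₂ i))
              ≡ ∑[ j < k ] w j
∑-bijection {m} e w = trans (sym (∑-splitAt m (λ x → w (Bijection.to e x))))
                            (sym (sum-permute w (⤖⇒↔ e ↔-∘ +↔⊎)))

oddEdge-xor : ∀ {N} {V : Set} (f : V → Fin N) x y →
              oddEdge f (x , y) ≡ even? (label f x) xor even? (label f y)
oddEdge-xor f x y rewrite n%2 (label f x) | n%2 (label f y) with even? (label f x) | even? (label f y)
... | false | false = refl
... | false | true = refl
... | true | false = refl
... | true | true = refl

mod-toℕ : ∀ {n} .{{_ : NonZero n}} (i : Fin n) → toℕ i mod n ≡ i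
mod-toℕ i = toℕ-injective (trans (toℕ-fromℕ< _) (m<n⇒m%n≡m (toℕ<n i)))

toℕ-mod : ∀ {k n} .{{_ : NonZero n}} → k < n → toℕ (k mod n) ≡ k
toℕ-mod k<n = trans (toℕ-fromℕ< _) (m<n⇒m%n≡m k<n)

n-mod-n≡0 : ∀ m → suc m mod suc m ≡ Fin.zero
n-mod-n≡0 m = toℕ-injective (trans (toℕ-fromℕ< _) (n%n≡0 (suc m)))

module Colouring {m N : ℕ} (f : PV (suc m) → Fin N) where

  colour : PV (suc m) → Bool
  colour x = even? (label f x)

  -- Indexing the cycles by k mod n turns both into closed walks of length n.
  outer inner : ℕ → Bool
  outer k = colour (inj₁ (k mod suc m))
  inner k = colour (inj₂ (k mod suc m))

  outer-closed : outer (suc m) ≡ outer 0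
  outer-closed = cong (λ i → colour (inj₁ i)) (n-mod-n≡0 m)

  inner-closed : inner (suc m) ≡ inner 0
  inner-closed = cong (λ i → colour (inj₂ i)) (n-mod-n≡0 m)

  edgesAt : Fin (suc m) → List (PV (suc m) × PV (suc m))
  edgesAt i = (inj₁ i , inj₁ (shift 1 i)) ∷ (inj₁ i , inj₂ i) ∷ (inj₂ i , inj₂ (shift 1 i)) ∷ []

  oddEdge-colours : ∀ x y {a b} → colour x ≡ a → colour y ≡ b → 𝟙 (oddEdge f (x , y)) ≡ 𝟙 (a xor b)
  oddEdge-colours x y refl refl = cong 𝟙 (oddEdge-xor f x y)

  oddCount-edgesAt : ∀ (i : Fin (suc m)) →
    List.sum (map (λ e → 𝟙 (oddEdge f e)) (edgesAt i))
    ≡ 𝟙 (outer (toℕ i) xor outer (suc (toℕ i))) + 𝟙 (outer (toℕ i) xor inner (toℕ i))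
      + 𝟙 (inner (toℕ i) xor inner (suc (toℕ i)))
  oddCount-edgesAt i = begin
    a + (b + (c + 0))  ≡⟨ cong (λ c → a + (b + c)) (+-identityʳ c) ⟩
    a + (b + c)        ≡⟨ +-assoc a b c ⟨
    a + b + c          ≡⟨ cong₂ _+_ (cong₂ _+_ (oddEdge-colours _ _ here₁ next₁)
                                               (oddEdge-colours _ _ here₁ here₂))
                                    (oddEdge-colours _ _ here₂ next₂) ⟩
    _                  ∎
    where
    open ≡-Reasoning
    k = toℕ i
    a = 𝟙 (oddEdge f (inj₁ i , inj₁ (shift 1 i)))
    b = 𝟙 (oddEdge f (inj₁ i , inj₂ i))
    c = 𝟙 (oddEdge f (inj₂ i , inj₂ (shift 1 i)))
    here₁ : colour (inj₁ i) ≡ outer k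
    here₁ = cong (λ j → colour (inj₁ j)) (sym (mod-toℕ i))
    here₂ : colour (inj₂ i) ≡ inner k
    here₂ = cong (λ j → colour (inj₂ j)) (sym (mod-toℕ i))
    next₁ : colour (inj₁ (shift 1 i)) ≡ outer (suc k)
    next₁ = cong outer (+-comm k 1)
    next₂ : colour (inj₂ (shift 1 i)) ≡ inner (suc k)
    next₂ = cong inner (+-comm k 1)

  oddCount-PEdges : oddCount (PEdges (suc m) 1) f
                  ≡ changes outer (suc m) + mismatches outer inner (suc m) + changes inner (suc m)
  oddCount-PEdges = begin
    oddCount (PEdges n 1) f
      ≡⟨ length-filter (oddEdge f) (PEdges n 1) ⟩
    List.sum (map (λ e → 𝟙 (oddEdge f e)) (PEdges n 1))
      ≡⟨ sum-map-concatMap (λ e → 𝟙 (oddEdge f e)) edgesAt (allFin n) ⟩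
    List.sum (map oddCountAt (allFin n))
      ≡⟨ sum-map-tabulate oddCountAt (λ i → i) ⟩
    ∑[ i < n ] oddCountAt i
      ≡⟨ sum-cong-≗ {n} oddCount-edgesAt ⟩
    ∑[ i < n ] (O i + S i + I i)
      ≡⟨ ∑-distrib-+ {n} (λ i → O i + S i) I ⟩
    ∑[ i < n ] (O i + S i) + changes inner n
      ≡⟨ cong (_+ changes inner n) (∑-distrib-+ {n} O S) ⟩
    changes outer n + mismatches outer inner n + changes inner n ∎
    where
    open ≡-Reasoning
    n = suc m
    oddCountAt : Fin n → ℕ
    oddCountAt i = List.sum (map (λ e → 𝟙 (oddEdge f e)) (edgesAt i))
    O S I : Fin n → ℕ
    O i = 𝟙 (outer (toℕ i) xor outer (suc (toℕ i)))
    S i = 𝟙 (outer (toℕ i) xor inner (toℕ i))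
    I i = 𝟙 (inner (toℕ i) xor inner (suc (toℕ i)))

count-even?-suc : ∀ n → count (λ j → even? (suc j)) (n + n) ≡ n
count-even?-suc zero = refl
count-even?-suc (suc n) rewrite +-suc n n = cong suc (count-even?-suc n)

count-colours : ∀ m (f : PV (suc m) ⤖ Fin (suc m + suc m)) →
                let open Colouring (Bijection.to f) in count outer (suc m) + count inner (suc m) ≡ suc m
count-colours m f = begin
  count outer n + count inner n
    ≡⟨ cong₂ _+_ (sum-cong-≗ {n} (λ i → cong (λ j → 𝟙 (colour (inj₁ j))) (mod-toℕ i)))
                 (sum-cong-≗ {n} (λ i → cong (λ j → 𝟙 (colour (inj₂ j))) (mod-toℕ i))) ⟩
  ∑[ i < n ] 𝟙 (colour (inj₁ i)) + ∑[ i < n ] 𝟙 (colour (inj₂ i))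
    ≡⟨ ∑-bijection f (λ j → 𝟙 (even? (suc (toℕ j)))) ⟩
  count (λ j → even? (suc j)) (n + n)
    ≡⟨ count-even?-suc n ⟩
  n ∎
  where
  open ≡-Reasoning
  open Colouring (Bijection.to f)
  n = suc m

-- An optimal labelling

module _ {n : ℕ} where

  private
    n*2≡n+n : n * 2 ≡ n + n
    n*2≡n+n = trans (*-comm n 2) (cong (n +_) (+-identityʳ n))

    tag : Fin n ⊎ Fin n → Fin n × Fin 2
    tag (inj₁ a) = a , 0F
    tag (inj₂ a) = a , 1F

    untag : Fin n × Fin 2 → Fin n ⊎ Fin n
    untag (a , 0F) = inj₁ a
    untag (a , 1F) = inj₂ a

    ⊎↔×2 : (Fin n ⊎ Fin n) ↔ (Fin n × Fin 2)
    ⊎↔×2 = mk↔ₛ′ tag untag (λ { (a , 0F) → refl ; (a , 1F) → refl })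
                            (λ { (inj₁ a) → refl ; (inj₂ a) → refl })

    cast↔ : Fin (n * 2) ↔ Fin (n + n)
    cast↔ = mk↔ₛ′ (cast n*2≡n+n) (cast (sym n*2≡n+n))
                  (cast-involutive n*2≡n+n (sym n*2≡n+n)) (cast-involutive (sym n*2≡n+n) n*2≡n+n)

  interleave : (Fin n ⊎ Fin n) ↔ Fin (n + n)
  interleave = cast↔ ↔-∘ (↔-sym *↔× ↔-∘ ⊎↔×2)

  toℕ-interleave₁ : ∀ a → toℕ (Inverse.to interleave (inj₁ a)) ≡ 2 * toℕ a
  toℕ-interleave₁ a = trans (toℕ-cast n*2≡n+n (combine a 0F))
                            (trans (toℕ-combine a 0F) (+-identityʳ (2 * toℕ a)))

  toℕ-interleave₂ : ∀ a → toℕ (Inverse.to interleave (inj₂ a)) ≡ suc (2 * toℕ a)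
  toℕ-interleave₂ a = trans (toℕ-cast n*2≡n+n (combine a 1F))
                            (trans (toℕ-combine a 1F) (+-comm (2 * toℕ a) 1))

-- The vertex at position p of u₀, v₀, u₁, v₁, … gets label 2p + 1 if p < n and 2(p − n) + 2 otherwise.
labelling : ∀ n → PV n ⤖ Fin (n + n)
labelling n = ↔⇒⤖ (interleave {n} ↔-∘ (+↔⊎ {n} {n} ↔-∘ interleave {n}))

even?-interleave-splitAt : ∀ {n} (j : Fin (n + n)) →
                           even? (suc (toℕ (Inverse.to interleave (splitAt n j)))) ≡ (n ≤ᵇ toℕ j)
even?-interleave-splitAt {n} j with n ≤ᵇ toℕ j | ≤ᵇ-reflects-≤ n (toℕ j)
... | true | ofʸ n≤j rewrite splitAt-≥ n j n≤j | toℕ-interleave₂ (reduce≥ j n≤j) =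
  even?-2* (toℕ (reduce≥ j n≤j))
... | false | ofⁿ n≰j rewrite splitAt-< n j (≰⇒> n≰j) | toℕ-interleave₁ (fromℕ< (≰⇒> n≰j)) =
  trans (even?-suc (2 * toℕ (fromℕ< (≰⇒> n≰j)))) (cong not (even?-2* (toℕ (fromℕ< (≰⇒> n≰j)))))

≤ᵇ-increasing : ∀ n {a b} → a ≤ b → (n ≤ᵇ a) Bool.≤ (n ≤ᵇ b)
≤ᵇ-increasing n {a} {b} a≤b with n ≤ᵇ a | ≤ᵇ-reflects-≤ n a | n ≤ᵇ b | ≤ᵇ-reflects-≤ n b
... | true | ofʸ _ | true | _ = Bool.b≤b
... | true | ofʸ n≤a | false | ofⁿ n≰b = ⊥-elim (n≰b (≤-trans n≤a a≤b))
... | false | _ | _ | _ = ≤-minimum _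

≤ᵇ-xor-suc : ∀ n j → (n ≤ᵇ j) xor (n ≤ᵇ suc j) ≡ true → suc j ≡ n
≤ᵇ-xor-suc n j changed with n ≤ᵇ j | ≤ᵇ-reflects-≤ n j | n ≤ᵇ suc j | ≤ᵇ-reflects-≤ n (suc j)
... | true | ofʸ n≤j | false | ofⁿ n≰1+j = ⊥-elim (n≰1+j (m≤n⇒m≤1+n n≤j))
... | false | ofⁿ n≰j | true | ofʸ n≤1+j = ≤-antisym (≰⇒> n≰j) n≤1+j

labelling-upper-bound : ∀ m → oddCount (PEdges (suc m) 1) (Bijection.to (labelling (suc m))) ≤ σ⁻P (suc m)
labelling-upper-bound m = begin
  oddCount (PEdges n 1) (Bijection.to (labelling n))
    ≡⟨ oddCount-PEdges ⟩
  changes outer n + mismatches outer inner n + changes inner n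
    ≤⟨ +-mono-≤ (+-mono-≤ (closed-changes≤2 outer (λ k → upper-half (2 * k)) m increasing₁ outer≡)
                          (≤1⇒≤𝟙-odd (mismatches-parity outer inner n (count-colours m (labelling n)))
                                     mismatches≤1))
                (closed-changes≤2 inner (λ k → upper-half (suc (2 * k))) m increasing₂ inner≡) ⟩
  2 + 𝟙 (not (even? n)) + 2
    ≡⟨ σ⁻P-split n ⟨
  σ⁻P n ∎
  where
  n = suc m
  open Colouring (Bijection.to (labelling n))
  open ≤-Reasoning

  upper-half : ℕ → Bool
  upper-half j = n ≤ᵇ j

  outer≡ : ∀ k → k < n → outer k ≡ upper-half (2 * k)
  outer≡ k k<n = trans (even?-interleave-splitAt (Inverse.to interleave (inj₁ (k mod n))))
    (cong upper-half (trans (toℕ-interleave₁ (k mod n)) (cong (2 *_) (toℕ-mod k<n))))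

  inner≡ : ∀ k → k < n → inner k ≡ upper-half (suc (2 * k))
  inner≡ k k<n = trans (even?-interleave-splitAt (Inverse.to interleave (inj₂ (k mod n))))
    (cong upper-half (trans (toℕ-interleave₂ (k mod n)) (cong (λ i → suc (2 * i)) (toℕ-mod k<n))))

  increasing₁ : Increasing (λ k → upper-half (2 * k))
  increasing₁ k = ≤ᵇ-increasing n (*-monoʳ-≤ 2 (n≤1+n k))

  increasing₂ : Increasing (λ k → upper-half (suc (2 * k)))
  increasing₂ k = ≤ᵇ-increasing n (s≤s (*-monoʳ-≤ 2 (n≤1+n k)))

  mismatches≤1 : mismatches outer inner n ≤ 1
  mismatches≤1 = begin
    mismatches outer inner n
      ≡⟨ count-cong n (λ k k<n → cong₂ _xor_ (outer≡ k k<n) (inner≡ k k<n)) ⟩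
    count (λ k → upper-half (2 * k) xor upper-half (suc (2 * k))) n
      ≤⟨ count-unique n (λ j k changedⱼ changedₖ → *-cancelˡ-≡ j k 2
           (suc-injective (trans (≤ᵇ-xor-suc n _ changedⱼ) (sym (≤ᵇ-xor-suc n _ changedₖ))))) ⟩
    1 ∎

theorem4p7 : (n : ℕ) → 4 ≤ n → IsRnaPetersen n 1 (if even? n then 4 else 5)
theorem4p7 zero ()
theorem4p7 (suc m) 4≤n =
  (labelling (suc m) , ≤-antisym (labelling-upper-bound m) (lower-bound (labelling (suc m)))) , lower-bound
  where
  lower-bound : (f : PV (suc m) ⤖ Fin (suc m + suc m)) →
                σ⁻P (suc m) ≤ oddCount (PEdges (suc m) 1) (Bijection.to f)
  lower-bound f = subst (σ⁻P (suc m) ≤_) (sym oddCount-PEdges)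
    (rna-lower-bound outer inner (suc m) 4≤n outer-closed inner-closed (count-colours m f))
    where open Colouring (Bijection.to f)
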